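{- Let $k\ge 2$. For $2\le s\le k$ and $m\ge j\ge 2$, \[ GL_k(k(m-1)+s,j)=(z^{j-1}+z^j)q^{k\binom{j}{2}+sj+k(m-j)}{m-1\brack j-1}_k. \]
   Context: Overpartitions here are non-increasing sequences of positive integers in which the last occurrence of each distinct part value may be overlined; a part $t$ or $\overline t$ has size $t$, written $|\cdot|=t$; $|\lambda|$ is the sum of part sizes and $\ell_o(\lambda)$ the number of overlined parts. An $L_k$-overpartition is an overpartition $\pi=(\pi_1,\ldots,\pi_\ell)$ such that whenever $\pi_i$ is overlined, $\ell-i\equiv 0\pmod k$. For $m\ge1$, $\mathcal{BL}_k(m)$ is the set of $L_k$-overpartitions $\lambda=(\lambda_1,\ldots,\lambda_m)$ with exactly $m$ parts such that $\lambda_m=\overline1$ or $1$, and for $1\le i<m$, $|\lambda_i|\le|\lambda_{i+1}|+1$, with strict inequality if $\lambda_i$ is non-overlined. For $m,j\ge1$, $\mathcal{BL}_k(m,j)$ is the set of overpartitions in $\mathcal{BL}_k(m)$ whose largest part is (non-overlined) $j$, and $GL_k(m,j)=\sum_{\lambda\in\mathcal{BL}_k(m,j)}z^{\ell_o(\lambda)}q^{|\lambda|}$. Also ${A\brack B}_k=\frac{(q^k;q^k)_A}{(q^k;q^k)_B(q^k;q^k)_{A-B}}$ for $A\ge B\ge0$ and $0$ otherwise. -}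

module Defs where

open import Data.Nat using (ℕ; zero; suc; _+_; _*_; _∸_; _≤ᵇ_; _<ᵇ_; _≡ᵇ_)
open import Data.Nat.Divisibility using (_∣?_)
open import Data.Integer as ℤ using (ℤ; +_)
open import Data.Bool using (Bool; true; false; _∧_; _∨_; not; if_then_else_)
open import Data.List using (List; []; _∷_; length; map; concatMap; filter; applyUpTo; _++_; foldr)
open import Data.Product using (_×_; _,_; proj₁; proj₂)
open import Relation.Nullary.Decidable using (⌊_⌋)
open import Relation.Binary.PropositionalEquality using (_≡_)
open import Relation.Unary using (Pred)
open import Relation.Nullary using (yes; no)

-- Overpartitions
-- A part is (size t, overlined?) ; (t , true) stands for \overline t.

Part : Set
Part = ℕ × Bool

size : Part → ℕ
size = proj₁

ov : Part → Bool
ov = proj₂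

positive : List Part → Bool
positive [] = true
positive (x ∷ xs) = (1 ≤ᵇ size x) ∧ positive xs

nonIncr : List Part → Bool
nonIncr (x ∷ y ∷ xs) = (size y ≤ᵇ size x) ∧ nonIncr (y ∷ xs)
nonIncr _ = true

-- only the last occurrence of a value may be overlined
-- (in a non-increasing sequence: an overlined part is followed by a strictly smaller one)
overlineLast : List Part → Bool
overlineLast (x ∷ y ∷ xs) = (not (ov x) ∨ (size y <ᵇ size x)) ∧ overlineLast (y ∷ xs)
overlineLast _ = true

isOverpartition : List Part → Bool
isOverpartition λs = positive λs ∧ nonIncr λs ∧ overlineLast λs

-- L_k condition: if π_i is overlined then k ∣ (ℓ - i); here ℓ - i = number of parts after π_i
lkCond : ℕ → List Part → Bool
lkCond k [] = true
lkCond k (x ∷ xs) = (not (ov x) ∨ ⌊ k ∣? length xs ⌋) ∧ lkCond k xs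

isLk : ℕ → List Part → Bool
isLk k λs = isOverpartition λs ∧ lkCond k λs

lastIsOne : List Part → Bool
lastIsOne [] = false
lastIsOne (x ∷ []) = size x ≡ᵇ 1
lastIsOne (x ∷ y ∷ xs) = lastIsOne (y ∷ xs)

blChain : List Part → Bool
blChain (x ∷ y ∷ xs) =
  (if ov x then size x ≤ᵇ size y + 1 else size x <ᵇ size y + 1) ∧ blChain (y ∷ xs)
blChain _ = true

isBL : ℕ → ℕ → List Part → Bool
isBL k m λs = (length λs ≡ᵇ m) ∧ isLk k λs ∧ lastIsOne λs ∧ blChain λs

largestIs : ℕ → List Part → Bool
largestIs j [] = false
largestIs j (x ∷ xs) = (size x ≡ᵇ j) ∧ not (ov x)

isBLj : ℕ → ℕ → ℕ → List Part → Bool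
isBLj k m j λs = isBL k m λs ∧ largestIs j λs

-- all lists of n parts with sizes in {1,…,j}, each size with both overline flags.
-- Every element of BL_k(m,j) has m parts of sizes in {1,…,j}, so it occurs
-- exactly once in candidates m j.
partsUpTo : ℕ → List Part
partsUpTo j = concatMap (λ t → (t , false) ∷ (t , true) ∷ []) (applyUpTo suc j)

candidates : ℕ → ℕ → List (List Part)
candidates zero j = [] ∷ []
candidates (suc n) j = concatMap (λ p → map (p ∷_) (candidates n j)) (partsUpTo j)

BLset : ℕ → ℕ → ℕ → List (List Part)
BLset k m j = filter (λ λs → isBLj k m j λs Data.Bool.≟ true) (candidates m j)
  where import Data.Bool

-- Polynomials in z and q with integer coefficients, as lists of terms
-- (coefficient , z-exponent , q-exponent), compared coefficientwise.

Poly : Set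
Poly = List (ℤ × ℕ × ℕ)

coeff : Poly → ℕ → ℕ → ℤ
coeff [] a b = + 0
coeff ((c , e , f) ∷ ps) a b =
  (if (e ≡ᵇ a) ∧ (f ≡ᵇ b) then c else + 0) ℤ.+ coeff ps a b

_≈P_ : Poly → Poly → Set
P ≈P Q = ∀ a b → coeff P a b ≡ coeff Q a b

_+P_ : Poly → Poly → Poly
P +P Q = P ++ Q

_*P_ : Poly → Poly → Poly
P *P Q = concatMap (λ { (c , e , f) → map (λ { (c' , e' , f') → (c ℤ.* c' , e + e' , f + f') }) Q }) P

zq : ℕ → ℕ → Poly
zq a b = (+ 1 , a , b) ∷ []

oneP : Poly
oneP = zq 0 0

weight : List Part → ℕ
weight = foldr (λ p n → size p + n) 0

numOv : List Part → ℕ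
numOv = foldr (λ p n → (if ov p then 1 else 0) + n) 0

GL : ℕ → ℕ → ℕ → Poly
GL k m j = concatMap (λ λs → zq (numOv λs) (weight λs)) (BLset k m j)

qPoch : ℕ → ℕ → Poly
qPoch k zero = oneP
qPoch k (suc n) = qPoch k n *P (oneP +P ((ℤ.-[1+ 0 ] , 0 , k * suc n) ∷ []))

-- Read downwards from its largest part, an element of BL_k(m, j) is determined by its overline
-- flags: a non-overlined part t is followed by a part t, an overlined part t by a part t - 1,
-- and a part may be overlined only if the number of parts after it is a multiple of k. So the
-- generating polynomial U(n, t) = chainsOfSize k j n t of admissible sequences that start with
-- a part of size t and have n further parts satisfies
--   U(n + 1, t + 1) = q^(t+1) U(n, t + 1) + [k ∣ n + 1] z q^(t+1) U(n, t).
-- Running this recurrence through blocks of k steps gives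
--   U(a k, t + 1) = (z^t + z^(t+1)) q^(a k + t + 1) q^(k C(t,2)) [a t]_k,
-- and multiplying by (q^k;q^k)_t (q^k;q^k)_(a-t) clears the Gaussian binomial.

module Submission where

open import Defs
open import Data.Nat using (ℕ; zero; suc; _+_; _*_; _∸_; _≤_; _<_; s≤s; z≤n; _≤ᵇ_; _<ᵇ_; _≡ᵇ_)
import Data.Nat.Properties as ℕP
open import Data.Nat.Tactic.RingSolver using (solve-∀)
open import Data.Nat.Divisibility using (_∣_; _∣?_; _∣0; ∣⇒≤; ∣m+n∣m⇒∣n; n∣m*n)
open import Data.Nat.Combinatorics using (_C_; nC1≡n; nCk+nC[k+1]≡[n+1]C[k+1])
open import Data.Integer as ℤ using (ℤ; +_; -[1+_])
import Data.Integer.Properties as ℤP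
open import Data.Bool as Bool using (Bool; true; false; _∧_; _∨_; not; if_then_else_)
import Data.Bool.Properties as BP
import Algebra.Solver.CommutativeMonoid
open import Data.List using (List; []; _∷_; _++_; map; concat; concatMap; applyUpTo; length; filter)
open import Data.List.Relation.Unary.All as All using (All; []; _∷_)
import Data.List.Relation.Unary.All.Properties as AllP
import Data.List.Properties as LP
open import Data.Product using (_×_; _,_)
open import Data.Sum using (_⊎_; inj₁; inj₂)
open import Relation.Binary.PropositionalEquality
open import Relation.Nullary.Decidable using (⌊_⌋; isYes≗does; dec-true; dec-false)
open import Relation.Nullary using (¬_; contradiction)
open import Function using (_∘_)
open import Algebra.Bundles using (CommutativeSemiring)
open import Relation.Binary.Bundles using (Setoid)
open import Level using (0ℓ)
import Relation.Binary.Reasoning.Setoid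
open import Algebra.Structures.Biased using (isCommutativeSemiringˡ)
import Algebra.Solver.Ring.NaturalCoefficients.Default

<ᵇ-suc : ∀ m n → (m <ᵇ suc n) ≡ (m ≤ᵇ n)
<ᵇ-suc zero    n = refl
<ᵇ-suc (suc m) n = refl

≡ᵇ-refl : ∀ n → (n ≡ᵇ n) ≡ true
≡ᵇ-refl zero    = refl
≡ᵇ-refl (suc n) = ≡ᵇ-refl n

≢⇒≡ᵇ-false : ∀ m n → m ≢ n → (m ≡ᵇ n) ≡ false
≢⇒≡ᵇ-false zero    zero    0≢0 = contradiction refl 0≢0
≢⇒≡ᵇ-false zero    (suc n) _   = refl
≢⇒≡ᵇ-false (suc m) zero    _   = refl
≢⇒≡ᵇ-false (suc m) (suc n) m+1≢n+1 = ≢⇒≡ᵇ-false m n (m+1≢n+1 ∘ cong suc)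

≡ᵇ-+ : ∀ m n o → (m + n ≡ᵇ o) ≡ (m ≤ᵇ o) ∧ (n ≡ᵇ o ∸ m)
≡ᵇ-+ zero    n o       = refl
≡ᵇ-+ (suc m) n zero    = refl
≡ᵇ-+ (suc m) n (suc o) = trans (≡ᵇ-+ m n o) (cong (_∧ (n ≡ᵇ o ∸ m)) (sym (<ᵇ-suc m o)))

≤ᵇ∧<ᵇ+1 : ∀ m n → (m ≤ᵇ n) ∧ (n <ᵇ m + 1) ≡ (m ≡ᵇ n)
≤ᵇ∧<ᵇ+1 zero    zero    = refl
≤ᵇ∧<ᵇ+1 zero    (suc n) = refl
≤ᵇ∧<ᵇ+1 (suc m) zero    = refl
≤ᵇ∧<ᵇ+1 (suc m) (suc n) = trans (cong (_∧ (n <ᵇ m + 1)) (<ᵇ-suc m n)) (≤ᵇ∧<ᵇ+1 m n)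

≤ᵇ-suc∧≡ᵇ : ∀ m n → (m ≤ᵇ suc n) ∧ (m ≡ᵇ n) ≡ (m ≡ᵇ n)
≤ᵇ-suc∧≡ᵇ zero    n       = refl
≤ᵇ-suc∧≡ᵇ (suc m) zero    = BP.∧-zeroʳ (m <ᵇ 1)
≤ᵇ-suc∧≡ᵇ (suc m) (suc n) = trans (cong (_∧ (m ≡ᵇ n)) (<ᵇ-suc m (suc n))) (≤ᵇ-suc∧≡ᵇ m n)

if-∧ : ∀ {A : Set} a b (X : List A) → (if a ∧ b then X else []) ≡ (if a then (if b then X else []) else [])
if-∧ false b X = refl
if-∧ true  b X = refl

if-∧-comm : ∀ {A : Set} a b (X : List A) → (if a ∧ b then X else []) ≡ (if b then (if a then X else []) else [])
if-∧-comm false false X = refl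
if-∧-comm false true  X = refl
if-∧-comm true  false X = refl
if-∧-comm true  true  X = refl

Term : Set
Term = ℤ × ℕ × ℕ

_·_ : Term → Term → Term
(c , e , f) · (c′ , e′ , f′) = (c ℤ.* c′ , e + e′ , f + f′)

·-comm : ∀ t u → t · u ≡ u · t
·-comm (c , e , f) (c′ , e′ , f′)
  rewrite ℤP.*-comm c c′ | ℕP.+-comm e e′ | ℕP.+-comm f f′ = refl

·-assoc : ∀ t u v → (t · u) · v ≡ t · (u · v)
·-assoc (c , e , f) (c′ , e′ , f′) (c″ , e″ , f″)
  rewrite ℤP.*-assoc c c′ c″ | ℕP.+-assoc e e′ e″ | ℕP.+-assoc f f′ f″ = refl

termCoeff : Term → ℕ → ℕ → ℤ
termCoeff (c , e , f) a b = if (e ≡ᵇ a) ∧ (f ≡ᵇ b) then c else + 0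

-- _≈P_ wrapped in a record, so that both polynomials can be inferred from a proof.
infix 4 _≋_
record _≋_ (P Q : Poly) : Set where
  constructor coeffwise
  field coeff-≡ : P ≈P Q
open _≋_

≋-refl : ∀ {P} → P ≋ P
≋-refl = coeffwise λ _ _ → refl

≋-sym : ∀ {P Q} → P ≋ Q → Q ≋ P
≋-sym (coeffwise eq) = coeffwise λ a b → sym (eq a b)

≋-trans : ∀ {P Q R} → P ≋ Q → Q ≋ R → P ≋ R
≋-trans (coeffwise eq) (coeffwise eq′) = coeffwise λ a b → trans (eq a b) (eq′ a b)

≡⇒≋ : ∀ {P Q} → P ≡ Q → P ≋ Q
≡⇒≋ refl = ≋-refl

≋-setoid : Setoid 0ℓ 0ℓ
≋-setoid = record
  { Carrier = Poly ; _≈_ = _≋_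
  ; isEquivalence = record { refl = ≋-refl ; sym = ≋-sym ; trans = ≋-trans } }

module ≋-Reasoning = Relation.Binary.Reasoning.Setoid ≋-setoid

coeff-++ : ∀ P Q a b → coeff (P ++ Q) a b ≡ coeff P a b ℤ.+ coeff Q a b
coeff-++ []      Q a b = sym (ℤP.+-identityˡ _)
coeff-++ (t ∷ P) Q a b = trans (cong (λ x → termCoeff t a b ℤ.+ x) (coeff-++ P Q a b))
                               (sym (ℤP.+-assoc (termCoeff t a b) (coeff P a b) (coeff Q a b)))

+P-cong : ∀ {P P′ Q Q′} → P ≋ P′ → Q ≋ Q′ → P +P Q ≋ P′ +P Q′
+P-cong {P} {P′} {Q} {Q′} (coeffwise eq) (coeffwise eq′) = coeffwise λ a b → begin
  coeff (P ++ Q) a b              ≡⟨ coeff-++ P Q a b ⟩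
  coeff P a b ℤ.+ coeff Q a b     ≡⟨ cong₂ ℤ._+_ (eq a b) (eq′ a b) ⟩
  coeff P′ a b ℤ.+ coeff Q′ a b   ≡⟨ coeff-++ P′ Q′ a b ⟨
  coeff (P′ ++ Q′) a b            ∎
  where open ≡-Reasoning

+P-comm : ∀ P Q → P +P Q ≋ Q +P P
+P-comm P Q = coeffwise λ a b → begin
  coeff (P ++ Q) a b            ≡⟨ coeff-++ P Q a b ⟩
  coeff P a b ℤ.+ coeff Q a b   ≡⟨ ℤP.+-comm (coeff P a b) _ ⟩
  coeff Q a b ℤ.+ coeff P a b   ≡⟨ coeff-++ Q P a b ⟨
  coeff (Q ++ P) a b            ∎
  where open ≡-Reasoning

+P-swap : ∀ P Q R → P +P (Q +P R) ≋ Q +P (P +P R)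
+P-swap P Q R = ≋-trans (≡⇒≋ (sym (LP.++-assoc P Q R)))
  (≋-trans (+P-cong (+P-comm P Q) ≋-refl) (≡⇒≋ (LP.++-assoc Q P R)))

termCoeff-· : ∀ c e f t a b → termCoeff ((c , e , f) · t) a b
  ≡ (if (e ≤ᵇ a) ∧ (f ≤ᵇ b) then c ℤ.* termCoeff t (a ∸ e) (b ∸ f) else + 0)
termCoeff-· c e f (c′ , e′ , f′) a b rewrite ≡ᵇ-+ e e′ a | ≡ᵇ-+ f f′ b
  with e ≤ᵇ a | e′ ≡ᵇ a ∸ e | f ≤ᵇ b | f′ ≡ᵇ b ∸ f
... | false | _     | _     | _     = refl
... | true  | false | false | _     = refl
... | true  | false | true  | _     = sym (ℤP.*-zeroʳ c)
... | true  | true  | false | _     = refl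
... | true  | true  | true  | false = sym (ℤP.*-zeroʳ c)
... | true  | true  | true  | true  = refl

coeff-scale : ∀ c e f Q a b → coeff (map ((c , e , f) ·_) Q) a b
  ≡ (if (e ≤ᵇ a) ∧ (f ≤ᵇ b) then c ℤ.* coeff Q (a ∸ e) (b ∸ f) else + 0)
coeff-scale c e f [] a b with (e ≤ᵇ a) ∧ (f ≤ᵇ b)
... | false = refl
... | true  = sym (ℤP.*-zeroʳ c)
coeff-scale c e f (t ∷ Q) a b rewrite termCoeff-· c e f t a b | coeff-scale c e f Q a b
  with (e ≤ᵇ a) ∧ (f ≤ᵇ b)
... | false = refl
... | true  = sym (ℤP.*-distribˡ-+ c (termCoeff t (a ∸ e) (b ∸ f)) (coeff Q (a ∸ e) (b ∸ f)))

scale-cong : ∀ t {Q Q′} → Q ≋ Q′ → map (t ·_) Q ≋ map (t ·_) Q′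
scale-cong (c , e , f) {Q} {Q′} (coeffwise eq) = coeffwise λ a b → begin
  coeff (map ((c , e , f) ·_) Q) a b
    ≡⟨ coeff-scale c e f Q a b ⟩
  (if (e ≤ᵇ a) ∧ (f ≤ᵇ b) then c ℤ.* coeff Q (a ∸ e) (b ∸ f) else + 0)
    ≡⟨ cong (λ x → if (e ≤ᵇ a) ∧ (f ≤ᵇ b) then c ℤ.* x else + 0) (eq (a ∸ e) (b ∸ f)) ⟩
  (if (e ≤ᵇ a) ∧ (f ≤ᵇ b) then c ℤ.* coeff Q′ (a ∸ e) (b ∸ f) else + 0)
    ≡⟨ coeff-scale c e f Q′ a b ⟨
  coeff (map ((c , e , f) ·_) Q′) a b ∎
  where open ≡-Reasoning

*P-congˡ : ∀ P {Q Q′} → Q ≋ Q′ → P *P Q ≋ P *P Q′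
*P-congˡ []      eq = ≋-refl
*P-congˡ (t ∷ P) eq = +P-cong (scale-cong t eq) (*P-congˡ P eq)

*P-zeroʳ : ∀ P → P *P [] ≡ []
*P-zeroʳ []      = refl
*P-zeroʳ (t ∷ P) = *P-zeroʳ P

*P-identityˡ : ∀ P → oneP *P P ≡ P
*P-identityˡ P = trans (LP.++-identityʳ _) (map-one P)
  where
  map-one : ∀ P → map ((+ 1 , 0 , 0) ·_) P ≡ P
  map-one []              = refl
  map-one ((c , e , f) ∷ P) = cong₂ _∷_ (cong (_, e , f) (ℤP.*-identityˡ c)) (map-one P)

*P-distribʳ : ∀ R P Q → (P +P Q) *P R ≡ (P *P R) +P (Q *P R)
*P-distribʳ R P Q = LP.concatMap-++ (λ t → map (t ·_) R) P Q

scale-*P : ∀ t Q R → map (t ·_) Q *P R ≡ map (t ·_) (Q *P R)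
scale-*P t []      R = refl
scale-*P t (u ∷ Q) R = begin
  map ((t · u) ·_) R ++ map (t ·_) Q *P R
    ≡⟨ cong₂ _++_ (LP.map-cong (·-assoc t u) R) (scale-*P t Q R) ⟩
  map (λ v → t · (u · v)) R ++ map (t ·_) (Q *P R)
    ≡⟨ cong (_++ _) (LP.map-∘ R) ⟩
  map (t ·_) (map (u ·_) R) ++ map (t ·_) (Q *P R)
    ≡⟨ LP.map-++ (t ·_) (map (u ·_) R) (Q *P R) ⟨
  map (t ·_) (map (u ·_) R ++ Q *P R) ∎
  where open ≡-Reasoning

*P-assoc : ∀ P Q R → (P *P Q) *P R ≡ P *P (Q *P R)
*P-assoc []      Q R = refl
*P-assoc (t ∷ P) Q R = begin
  (map (t ·_) Q ++ P *P Q) *P R           ≡⟨ *P-distribʳ R (map (t ·_) Q) (P *P Q) ⟩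
  map (t ·_) Q *P R ++ (P *P Q) *P R      ≡⟨ cong₂ _++_ (scale-*P t Q R) (*P-assoc P Q R) ⟩
  map (t ·_) (Q *P R) ++ P *P (Q *P R)    ∎
  where open ≡-Reasoning

*P-∷ʳ : ∀ Q t P → Q *P (t ∷ P) ≋ map (_· t) Q +P (Q *P P)
*P-∷ʳ []      t P = ≋-refl
*P-∷ʳ (u ∷ Q) t P = +P-cong (≋-refl {(u · t) ∷ []})
  (≋-trans (+P-cong (≋-refl {map (u ·_) P}) (*P-∷ʳ Q t P)) (+P-swap (map (u ·_) P) (map (_· t) Q) (Q *P P)))

*P-comm : ∀ P Q → P *P Q ≋ Q *P P
*P-comm []      Q = ≡⇒≋ (sym (*P-zeroʳ Q))
*P-comm (t ∷ P) Q = begin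
  map (t ·_) Q +P (P *P Q)     ≈⟨ +P-cong (≡⇒≋ (LP.map-cong (·-comm t) Q)) (*P-comm P Q) ⟩
  map (_· t) Q +P (Q *P P)     ≈⟨ *P-∷ʳ Q t P ⟨
  Q *P (t ∷ P)                 ∎
  where open ≋-Reasoning

*P-cong : ∀ {P P′ Q Q′} → P ≋ P′ → Q ≋ Q′ → P *P Q ≋ P′ *P Q′
*P-cong {P} {P′} {Q} {Q′} P≋P′ Q≋Q′ = begin
  P *P Q      ≈⟨ *P-congˡ P Q≋Q′ ⟩
  P *P Q′     ≈⟨ *P-comm P Q′ ⟩
  Q′ *P P     ≈⟨ *P-congˡ Q′ P≋P′ ⟩
  Q′ *P P′    ≈⟨ *P-comm Q′ P′ ⟩
  P′ *P Q′    ∎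
  where open ≋-Reasoning

polySemiring : CommutativeSemiring 0ℓ 0ℓ
polySemiring = record
  { Carrier = Poly ; _≈_ = _≋_ ; _+_ = _+P_ ; _*_ = _*P_ ; 0# = [] ; 1# = oneP
  ; isCommutativeSemiring = isCommutativeSemiringˡ record
    { +-isCommutativeMonoid = record
      { isMonoid = record
        { isSemigroup = record
          { isMagma = record { isEquivalence = Setoid.isEquivalence ≋-setoid ; ∙-cong = +P-cong }
          ; assoc = λ P Q R → ≡⇒≋ (LP.++-assoc P Q R) }
        ; identity = (λ P → ≋-refl) , (λ P → ≡⇒≋ (LP.++-identityʳ P)) }
      ; comm = +P-comm }
    ; *-isCommutativeMonoid = record
      { isMonoid = record
        { isSemigroup = record
          { isMagma = record { isEquivalence = Setoid.isEquivalence ≋-setoid ; ∙-cong = *P-cong }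
          ; assoc = λ P Q R → ≡⇒≋ (*P-assoc P Q R) }
        ; identity = (λ P → ≡⇒≋ (*P-identityˡ P))
                   , (λ P → ≋-trans (*P-comm P oneP) (≡⇒≋ (*P-identityˡ P))) }
      ; comm = *P-comm }
    ; distribʳ = λ R P Q → ≡⇒≋ (*P-distribʳ R P Q)
    ; zeroˡ = λ P → ≋-refl } }

module PolySolver = Algebra.Solver.Ring.NaturalCoefficients.Default polySemiring

open PolySolver using (solve; _:=_; _:+_; _:*_; con)

*P-distribˡ : ∀ M P Q → M *P (P +P Q) ≋ (M *P P) +P (M *P Q)
*P-distribˡ = CommutativeSemiring.distribˡ polySemiring

oneMinusQ : ℕ → Poly
oneMinusQ e = oneP +P ((-[1+ 0 ] , 0 , e) ∷ [])

oneMinusQ-+ : ∀ x y → ((zq 0 x *P oneMinusQ y) +P oneMinusQ x) ≋ oneMinusQ (x + y)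
oneMinusQ-+ x y =
  ≋-trans (≡⇒≋ (cong (λ u → (+ 1 , 0 , u) ∷ (-[1+ 0 ] , 0 , x + y) ∷ oneMinusQ x) (ℕP.+-identityʳ x)))
          (coeffwise cancel)
  where
  cancel : ∀ a b → coeff ((+ 1 , 0 , x) ∷ (-[1+ 0 ] , 0 , x + y) ∷ (+ 1 , 0 , 0) ∷ (-[1+ 0 ] , 0 , x) ∷ []) a b
                 ≡ coeff (oneMinusQ (x + y)) a b
  cancel a b with 0 ≡ᵇ a | x ≡ᵇ b | x + y ≡ᵇ b | 0 ≡ᵇ b
  ... | false | _     | _     | _     = refl
  ... | true  | false | false | false = refl
  ... | true  | false | false | true  = refl
  ... | true  | false | true  | false = refl
  ... | true  | false | true  | true  = refl
  ... | true  | true  | false | false = refl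
  ... | true  | true  | false | true  = refl
  ... | true  | true  | true  | false = refl
  ... | true  | true  | true  | true  = refl

concatMap-≋ : ∀ {A : Set} {f g : A → Poly} (L : List A) → (∀ x → f x ≋ g x) → concatMap f L ≋ concatMap g L
concatMap-≋ []      f≋g = ≋-refl
concatMap-≋ (x ∷ L) f≋g = +P-cong (f≋g x) (concatMap-≋ L f≋g)

concatMap-vanishes : ∀ {A : Set} {f : A → Poly} {L : List A} → All (λ x → f x ≋ []) L → concatMap f L ≋ []
concatMap-vanishes []          = ≋-refl
concatMap-vanishes (fx≋[] ∷ p) = +P-cong fx≋[] (concatMap-vanishes p)

*P-concatMap : ∀ {A : Set} M (f : A → Poly) L → concatMap (λ x → M *P f x) L ≋ M *P concatMap f L
*P-concatMap M f []      = ≡⇒≋ (sym (*P-zeroʳ M))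
*P-concatMap M f (x ∷ L) =
  ≋-trans (+P-cong ≋-refl (*P-concatMap M f L)) (≋-sym (*P-distribˡ M (f x) (concatMap f L)))

concatMap-[] : ∀ {A B : Set} (L : List A) → concatMap (λ _ → []) L ≡ ([] {A = B})
concatMap-[] []      = refl
concatMap-[] (x ∷ L) = concatMap-[] L

concatMap-if : ∀ {A B : Set} b (f : A → List B) L →
  concatMap (λ x → if b then f x else []) L ≡ (if b then concatMap f L else [])
concatMap-if true  f L = refl
concatMap-if false f L = concatMap-[] L

concatMap-concatMap : ∀ {A B C : Set} (f : B → List C) (g : A → List B) L →
  concatMap f (concatMap g L) ≡ concatMap (λ x → concatMap f (g x)) L
concatMap-concatMap f g []      = refl
concatMap-concatMap f g (x ∷ L) =
  trans (LP.concatMap-++ f (g x) (concatMap g L)) (cong (concatMap f (g x) ++_) (concatMap-concatMap f g L))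

concatMap-filter : ∀ {A B : Set} (f : A → List B) (p : A → Bool) L →
  concatMap f (filter (λ x → p x Bool.≟ true) L) ≡ concatMap (λ x → if p x then f x else []) L
concatMap-filter f p []      = refl
concatMap-filter f p (x ∷ L) with p x
... | true  = cong (f x ++_) (concatMap-filter f p L)
... | false = concatMap-filter f p L

module _ (H : ℕ → Poly) {t : ℕ} (H-vanishes : ∀ u → u ≢ t → H u ≋ []) where

  concatMap-upTo-below : ∀ j → j < t → concatMap H (applyUpTo suc j) ≋ []
  concatMap-upTo-below j j<t = concatMap-vanishes (AllP.applyUpTo⁺₁ suc j λ i<j →
    H-vanishes _ (λ i+1≡t → ℕP.<-irrefl i+1≡t (ℕP.≤-<-trans i<j j<t)))

  concatMap-upTo-single : ∀ j → 1 ≤ t → t ≤ j → concatMap H (applyUpTo suc j) ≋ H t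
  concatMap-upTo-single zero    (s≤s z≤n) ()
  concatMap-upTo-single (suc j) 1≤t t≤j+1 = begin
    concatMap H (applyUpTo suc (suc j))             ≡⟨ cong (concatMap H) (LP.applyUpTo-∷ʳ suc j) ⟨
    concatMap H (applyUpTo suc j ++ suc j ∷ [])     ≡⟨ LP.concatMap-++ H (applyUpTo suc j) (suc j ∷ []) ⟩
    concatMap H (applyUpTo suc j) +P (H (suc j) +P []) ≈⟨ last (ℕP.m≤n⇒m<n∨m≡n t≤j+1) ⟩
    H t                                             ∎
    where
    open ≋-Reasoning
    last : t < suc j ⊎ t ≡ suc j → concatMap H (applyUpTo suc j) +P (H (suc j) +P []) ≋ H t
    last (inj₁ (s≤s t≤j)) = ≋-trans
      (+P-cong (concatMap-upTo-single j 1≤t t≤j)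
               (+P-cong (H-vanishes (suc j) (λ j+1≡t → ℕP.<-irrefl (sym j+1≡t) (s≤s t≤j))) ≋-refl))
      (≡⇒≋ (LP.++-identityʳ (H t)))
    last (inj₂ refl) = +P-cong (concatMap-upTo-below j ℕP.≤-refl) (≡⇒≋ (LP.++-identityʳ (H t)))

concatMap-parts-size : ∀ (F : Part → Poly) {t} j → 1 ≤ t → t ≤ j →
  concatMap (λ p → if size p ≡ᵇ t then F p else []) (partsUpTo j) ≋ F (t , false) +P F (t , true)
concatMap-parts-size F {t} j 1≤t t≤j = begin
  concatMap (λ p → if size p ≡ᵇ t then F p else []) (partsUpTo j)
    ≡⟨ concatMap-concatMap _ (λ u → (u , false) ∷ (u , true) ∷ []) (applyUpTo suc j) ⟩
  concatMap H (applyUpTo suc j)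
    ≈⟨ concatMap-upTo-single H H-vanishes j 1≤t t≤j ⟩
  H t
    ≡⟨ cong (λ b → (if b then F (t , false) else []) ++ (if b then F (t , true) else []) ++ []) (≡ᵇ-refl t) ⟩
  F (t , false) +P (F (t , true) +P [])
    ≡⟨ cong (F (t , false) +P_) (LP.++-identityʳ (F (t , true))) ⟩
  F (t , false) +P F (t , true) ∎
  where
  open ≋-Reasoning
  H : ℕ → Poly
  H u = (if u ≡ᵇ t then F (u , false) else []) ++ (if u ≡ᵇ t then F (u , true) else []) ++ []
  H-vanishes : ∀ u → u ≢ t → H u ≋ []
  H-vanishes u u≢t = ≡⇒≋ (cong (λ b → (if b then F (u , false) else []) ++ (if b then F (u , true) else []) ++ [])
                              (≢⇒≡ᵇ-false u t u≢t))

candidates-length : ∀ n j → All (λ r → length r ≡ n) (candidates n j)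
candidates-length zero    j = refl ∷ []
candidates-length (suc n) j =
  AllP.concat⁺ (AllP.map⁺ (All.universal (λ p → AllP.map⁺ (All.map (cong suc) (candidates-length n j))) (partsUpTo j)))

concatMap-candidates-suc : ∀ {B : Set} (f : List Part → List B) n j → concatMap f (candidates (suc n) j)
  ≡ concatMap (λ p → concatMap (λ r → f (p ∷ r)) (candidates n j)) (partsUpTo j)
concatMap-candidates-suc f n j =
  trans (concatMap-concatMap f (λ p → map (p ∷_) (candidates n j)) (partsUpTo j))
        (LP.concatMap-cong (λ p → LP.concatMap-map f (p ∷_) (candidates n j)) (partsUpTo j))

-- qBinom k a r is q^(k·C(r,2)) times the Gaussian binomial [a r] in base q^k.
qBinom : ℕ → ℕ → ℕ → Poly
qBinom k a       zero    = oneP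
qBinom k zero    (suc r) = []
qBinom k (suc a) (suc r) = (zq 0 (k * suc r) *P qBinom k a (suc r)) +P (zq 0 (k * r) *P qBinom k a r)

qBinom-vanishes : ∀ k {a r} → a < r → qBinom k a r ≡ []
qBinom-vanishes k {zero}  {suc r} _         = refl
qBinom-vanishes k {suc a} {suc r} (s≤s a<r) =
  cong₂ (λ X Y → (zq 0 (k * suc r) *P X) +P (zq 0 (k * r) *P Y))
        (qBinom-vanishes k (ℕP.m<n⇒m<1+n a<r)) (qBinom-vanishes k a<r)

kC2-suc : ∀ k r → k * r + k * (r C 2) ≡ k * (suc r C 2)
kC2-suc k r = begin
  k * r + k * (r C 2)        ≡⟨ ℕP.*-distribˡ-+ k r (r C 2) ⟨
  k * (r + r C 2)            ≡⟨ cong (λ u → k * (u + r C 2)) (nC1≡n r) ⟨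
  k * (r C 1 + r C 2)        ≡⟨ cong (k *_) (nCk+nC[k+1]≡[n+1]C[k+1] r 1) ⟩
  k * (suc r C 2)            ∎
  where open ≡-Reasoning

qBinom-qPoch : ∀ k {a r} → r ≤ a →
  ((qBinom k a r *P qPoch k r) *P qPoch k (a ∸ r)) ≋ (zq 0 (k * (r C 2)) *P qPoch k a)
qBinom-qPoch k {a} {zero} _ = ≡⇒≋ (cong (λ u → zq 0 u *P qPoch k a) (sym (ℕP.*-zeroʳ k)))
qBinom-qPoch k {suc a} {suc r} (s≤s r≤a) with ℕP.m≤n⇒m<n∨m≡n r≤a
... | inj₂ refl rewrite qBinom-vanishes k (ℕP.n<1+n a) = begin
  ((Z₀ *P B₀) *P (Pa *P Da)) *P T
    ≈⟨ solve 5 (λ Z₀ B₀ Pa Da T → ((Z₀ :* B₀) :* (Pa :* Da)) :* T := Z₀ :* (((B₀ :* Pa) :* T) :* Da))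
               ≋-refl Z₀ B₀ Pa Da T ⟩
  Z₀ *P (((B₀ *P Pa) *P T) *P Da)
    ≈⟨ *P-congˡ Z₀ (*P-cong (qBinom-qPoch k r≤a) ≋-refl) ⟩
  Z₀ *P ((C₀ *P Pa) *P Da)
    ≈⟨ solve 4 (λ Z₀ C₀ Pa Da → Z₀ :* ((C₀ :* Pa) :* Da) := (Z₀ :* C₀) :* (Pa :* Da))
               ≋-refl Z₀ C₀ Pa Da ⟩
  zq 0 (k * a + k * (a C 2)) *P (Pa *P Da)
    ≡⟨ cong (λ u → zq 0 u *P (Pa *P Da)) (kC2-suc k a) ⟩
  zq 0 (k * (suc a C 2)) *P (Pa *P Da) ∎
  where
  open ≋-Reasoning
  Z₀ = zq 0 (k * a)
  B₀ = qBinom k a a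
  C₀ = zq 0 (k * (a C 2))
  Pa = qPoch k a
  Da = oneMinusQ (k * suc a)
  T = qPoch k (a ∸ a)
... | inj₁ r<a = begin
  (((Z₁ *P B₁) +P (Z₀ *P B₀)) *P (Pr *P Dr)) *P T
    ≈⟨ solve 7 (λ Z₁ B₁ Z₀ B₀ Pr Dr T → ((Z₁ :* B₁ :+ Z₀ :* B₀) :* (Pr :* Dr)) :* T
                := Z₁ :* ((B₁ :* (Pr :* Dr)) :* T) :+ (Z₀ :* ((B₀ :* Pr) :* T)) :* Dr)
               ≋-refl Z₁ B₁ Z₀ B₀ Pr Dr T ⟩
  (Z₁ *P ((B₁ *P (Pr *P Dr)) *P T)) +P ((Z₀ *P ((B₀ *P Pr) *P T)) *P Dr)
    ≈⟨ +P-cong (*P-congˡ Z₁ first) (*P-cong second ≋-refl) ⟩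
  (Z₁ *P ((C₁ *P Pa) *P Dm)) +P ((C₁ *P Pa) *P Dr)
    ≈⟨ solve 5 (λ Z₁ C₁ Pa Dm Dr → Z₁ :* ((C₁ :* Pa) :* Dm) :+ (C₁ :* Pa) :* Dr
                := (C₁ :* Pa) :* (Z₁ :* Dm :+ Dr)) ≋-refl Z₁ C₁ Pa Dm Dr ⟩
  (C₁ *P Pa) *P ((Z₁ *P Dm) +P Dr)
    ≈⟨ *P-congˡ (C₁ *P Pa) (oneMinusQ-+ (k * suc r) (k * suc m)) ⟩
  (C₁ *P Pa) *P oneMinusQ (k * suc r + k * suc m)
    ≡⟨ cong (λ u → (C₁ *P Pa) *P oneMinusQ u) exponent ⟩
  (C₁ *P Pa) *P oneMinusQ (k * suc a)
    ≡⟨ *P-assoc C₁ Pa (oneMinusQ (k * suc a)) ⟩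
  C₁ *P qPoch k (suc a) ∎
  where
  open ≋-Reasoning
  m = a ∸ suc r
  Z₁ = zq 0 (k * suc r)
  Z₀ = zq 0 (k * r)
  B₁ = qBinom k a (suc r)
  B₀ = qBinom k a r
  C₁ = zq 0 (k * (suc r C 2))
  Pr = qPoch k r
  Dr = oneMinusQ (k * suc r)
  Pa = qPoch k a
  Dm = oneMinusQ (k * suc m)
  T = qPoch k (a ∸ r)
  exponent : k * suc r + k * suc m ≡ k * suc a
  exponent = trans (sym (ℕP.*-distribˡ-+ k (suc r) (suc m)))
                   (cong (k *_) (trans (ℕP.+-suc (suc r) m) (cong suc (ℕP.m+[n∸m]≡n r<a))))
  first : (B₁ *P (Pr *P Dr)) *P T ≋ (C₁ *P Pa) *P Dm
  first = begin
    (B₁ *P (Pr *P Dr)) *P T            ≡⟨ cong (λ u → (B₁ *P (Pr *P Dr)) *P qPoch k u) (ℕP.+-∸-assoc 1 r<a) ⟩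
    (B₁ *P (Pr *P Dr)) *P (qPoch k m *P Dm)  ≡⟨ sym (*P-assoc (B₁ *P (Pr *P Dr)) (qPoch k m) Dm) ⟩
    ((B₁ *P (Pr *P Dr)) *P qPoch k m) *P Dm  ≈⟨ *P-cong (qBinom-qPoch k r<a) ≋-refl ⟩
    (C₁ *P Pa) *P Dm                    ∎
  second : Z₀ *P ((B₀ *P Pr) *P T) ≋ C₁ *P Pa
  second = begin
    Z₀ *P ((B₀ *P Pr) *P T)            ≈⟨ *P-congˡ Z₀ (qBinom-qPoch k (ℕP.<⇒≤ r<a)) ⟩
    Z₀ *P (zq 0 (k * (r C 2)) *P Pa)   ≡⟨ sym (*P-assoc Z₀ (zq 0 (k * (r C 2))) Pa) ⟩
    zq 0 (k * r + k * (r C 2)) *P Pa   ≡⟨ cong (λ u → zq 0 u *P Pa) (kC2-suc k r) ⟩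
    C₁ *P Pa                           ∎

∣⇒⌊∣?⌋≡true : ∀ {k n} → k ∣ n → ⌊ k ∣? n ⌋ ≡ true
∣⇒⌊∣?⌋≡true {k} {n} k∣n = trans (isYes≗does (k ∣? n)) (dec-true (k ∣? n) k∣n)

∤⇒⌊∣?⌋≡false : ∀ {k n} → ¬ (k ∣ n) → ⌊ k ∣? n ⌋ ≡ false
∤⇒⌊∣?⌋≡false {k} {n} k∤n = trans (isYes≗does (k ∣? n)) (dec-false (k ∣? n) k∤n)

suc[b]<k⇒k∤suc[b]+a*k : ∀ {k} a b → suc b < k → ¬ (k ∣ suc b + a * k)
suc[b]<k⇒k∤suc[b]+a*k {k} a b b<k k∣ =
  ℕP.<⇒≱ b<k (∣⇒≤ (∣m+n∣m⇒∣n (subst (k ∣_) (ℕP.+-comm (suc b) (a * k)) k∣) (n∣m*n a)))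

monomial : List Part → Poly
monomial λs = zq (numOv λs) (weight λs)

partMonomial : Part → Poly
partMonomial x = zq (if ov x then 1 else 0) (size x)

-- λs ∈ BL_k(m) iff length λs ≡ m and admissible k λs.
admissible : ℕ → List Part → Bool
admissible k λs = isLk k λs ∧ (lastIsOne λs ∧ blChain λs)

-- The conditions on consecutive parts x, y of an admissible sequence in which n parts follow y.
link : ℕ → ℕ → Part → Part → Bool
link k n x y = (1 ≤ᵇ size x) ∧ ((size y ≤ᵇ size x) ∧ ((not (ov x) ∨ (size y <ᵇ size x))
  ∧ ((not (ov x) ∨ ⌊ k ∣? suc n ⌋) ∧ (if ov x then size x ≤ᵇ size y + 1 else size x <ᵇ size y + 1))))

admissible-∷∷ : ∀ k x y r → admissible k (x ∷ y ∷ r) ≡ link k (length r) x y ∧ admissible k (y ∷ r)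
admissible-∷∷ k x y r = ∧-Solver.solve 11
  (λ pos pos′ dec dec′ last last′ div lk′ one chain chain′ →
     (((pos ⊕ pos′) ⊕ ((dec ⊕ dec′) ⊕ (last ⊕ last′))) ⊕ (div ⊕ lk′)) ⊕ (one ⊕ (chain ⊕ chain′))
     ⊜ (pos ⊕ (dec ⊕ (last ⊕ (div ⊕ chain)))) ⊕ (((pos′ ⊕ (dec′ ⊕ last′)) ⊕ lk′) ⊕ (one ⊕ chain′)))
  refl
  (1 ≤ᵇ size x) (positive (y ∷ r)) (size y ≤ᵇ size x) (nonIncr (y ∷ r))
  (not (ov x) ∨ (size y <ᵇ size x)) (overlineLast (y ∷ r)) (not (ov x) ∨ ⌊ k ∣? length (y ∷ r) ⌋)
  (lkCond k (y ∷ r)) (lastIsOne (y ∷ r)) (if ov x then size x ≤ᵇ size y + 1 else size x <ᵇ size y + 1)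
  (blChain (y ∷ r))
  where module ∧-Solver = Algebra.Solver.CommutativeMonoid BP.∧-commutativeMonoid
        open ∧-Solver using (_⊕_; _⊜_)

admissibleTerm : ℕ → List Part → Poly
admissibleTerm k λs = if admissible k λs then monomial λs else []

chains : ℕ → ℕ → ℕ → Part → Poly
chains k j n x = concatMap (λ r → admissibleTerm k (x ∷ r)) (candidates n j)

if-∧-*P : ∀ b c M X → (if b ∧ c then M *P X else []) ≡ (if b then M *P (if c then X else []) else [])
if-∧-*P false c     M X = refl
if-∧-*P true  true  M X = refl
if-∧-*P true  false M X = sym (*P-zeroʳ M)

chains-suc : ∀ k j n x → chains k j (suc n) x
  ≋ concatMap (λ y → if link k n x y then partMonomial x *P chains k j n y else []) (partsUpTo j)
chains-suc k j n x = begin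
  chains k j (suc n) x
    ≡⟨ concatMap-candidates-suc (λ r → admissibleTerm k (x ∷ r)) n j ⟩
  concatMap (λ y → concatMap (λ r → F x (y ∷ r)) (candidates n j)) (partsUpTo j)
    ≈⟨ concatMap-≋ (partsUpTo j) step ⟩
  concatMap (λ y → if link k n x y then partMonomial x *P chains k j n y else []) (partsUpTo j) ∎
  where
  open ≋-Reasoning
  F : Part → List Part → Poly
  F y r = admissibleTerm k (y ∷ r)
  unfold : ∀ y r → length r ≡ n → F x (y ∷ r) ≡ (if link k n x y then partMonomial x *P F y r else [])
  unfold y r refl = trans (cong (λ b → if b then monomial (x ∷ y ∷ r) else []) (admissible-∷∷ k x y r))
                          (if-∧-*P (link k (length r) x y) (admissible k (y ∷ r)) (partMonomial x) (monomial (y ∷ r)))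
  guarded : ∀ y b → (if b then concatMap (λ r → partMonomial x *P F y r) (candidates n j) else [])
                  ≋ (if b then partMonomial x *P chains k j n y else [])
  guarded y false = ≋-refl
  guarded y true  = *P-concatMap (partMonomial x) (F y) (candidates n j)
  step : ∀ y → concatMap (λ r → F x (y ∷ r)) (candidates n j)
             ≋ (if link k n x y then partMonomial x *P chains k j n y else [])
  step y = begin
    concatMap (λ r → F x (y ∷ r)) (candidates n j)
      ≡⟨ cong concat (LP.map-cong-local (All.map (λ {r} → unfold y r) (candidates-length n j))) ⟩
    concatMap (λ r → if link k n x y then partMonomial x *P F y r else []) (candidates n j)
      ≡⟨ concatMap-if (link k n x y) (λ r → partMonomial x *P F y r) (candidates n j) ⟩
    (if link k n x y then concatMap (λ r → partMonomial x *P F y r) (candidates n j) else [])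
      ≈⟨ guarded y (link k n x y) ⟩
    (if link k n x y then partMonomial x *P chains k j n y else []) ∎

GL-chains : ∀ k j n → 1 ≤ j → GL k (suc n) j ≋ chains k j n (j , false)
GL-chains k j n 1≤j = begin
  GL k (suc n) j
    ≡⟨ concatMap-filter monomial (isBLj k (suc n) j) (candidates (suc n) j) ⟩
  concatMap E (candidates (suc n) j)
    ≡⟨ concatMap-candidates-suc E n j ⟩
  concatMap (λ p → concatMap (λ r → E (p ∷ r)) (candidates n j)) (partsUpTo j)
    ≡⟨ LP.concatMap-cong byTop (partsUpTo j) ⟩
  concatMap (λ p → if size p ≡ᵇ j then F p else []) (partsUpTo j)
    ≈⟨ concatMap-parts-size F j 1≤j ℕP.≤-refl ⟩
  chains k j n (j , false) +P []
    ≡⟨ LP.++-identityʳ (chains k j n (j , false)) ⟩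
  chains k j n (j , false) ∎
  where
  open ≋-Reasoning
  E : List Part → Poly
  E λs = if isBLj k (suc n) j λs then monomial λs else []
  F : Part → Poly
  F p = if not (ov p) then chains k j n p else []
  unfold : ∀ p r → length r ≡ n →
    E (p ∷ r) ≡ (if size p ≡ᵇ j then (if not (ov p) then admissibleTerm k (p ∷ r) else []) else [])
  unfold p r refl =
    trans (cong (λ b → if (b ∧ admissible k (p ∷ r)) ∧ largestIs j (p ∷ r) then monomial (p ∷ r) else [])
                (≡ᵇ-refl (length r)))
    (trans (if-∧-comm (admissible k (p ∷ r)) (largestIs j (p ∷ r)) (monomial (p ∷ r)))
           (if-∧ (size p ≡ᵇ j) (not (ov p)) (admissibleTerm k (p ∷ r))))
  byTop : ∀ p → concatMap (λ r → E (p ∷ r)) (candidates n j) ≡ (if size p ≡ᵇ j then F p else [])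
  byTop p =
    trans (cong concat (LP.map-cong-local (All.map (λ {r} → unfold p r) (candidates-length n j))))
    (trans (concatMap-if (size p ≡ᵇ j) _ (candidates n j))
           (cong (λ X → if size p ≡ᵇ j then X else []) (concatMap-if (not (ov p)) _ (candidates n j))))

link-plain : ∀ k n t y → link k n (suc t , false) y ≡ (size y ≡ᵇ suc t)
link-plain k n t y = ≤ᵇ∧<ᵇ+1 (size y) (suc t)

link-overlined : ∀ k n t y → link k n (suc t , true) y ≡ ⌊ k ∣? suc n ⌋ ∧ (size y ≡ᵇ t)
link-overlined k n t (u , o) rewrite <ᵇ-suc u t with ⌊ k ∣? suc n ⌋
... | true  = trans (cong ((u ≤ᵇ suc t) ∧_) (≤ᵇ∧<ᵇ+1 u t)) (≤ᵇ-suc∧≡ᵇ u t)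
... | false = trans (cong ((u ≤ᵇ suc t) ∧_) (BP.∧-zeroʳ (u ≤ᵇ t))) (BP.∧-zeroʳ (u ≤ᵇ suc t))

chainsOfSize : ℕ → ℕ → ℕ → ℕ → Poly
chainsOfSize k j n t = chains k j n (t , false) +P chains k j n (t , true)

chains-zero-size : ∀ k j n o → chains k j n (0 , o) ≡ []
chains-zero-size k j n o = concatMap-[] (candidates n j)

chainsOfSize-zero : ∀ k j n → chainsOfSize k j n 0 ≡ []
chainsOfSize-zero k j n = cong₂ _++_ (chains-zero-size k j n false) (chains-zero-size k j n true)

chains-plain-suc : ∀ k j n t → suc t ≤ j →
  chains k j (suc n) (suc t , false) ≋ zq 0 (suc t) *P chainsOfSize k j n (suc t)
chains-plain-suc k j n t t<j = begin
  chains k j (suc n) (suc t , false)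
    ≈⟨ chains-suc k j n (suc t , false) ⟩
  concatMap (λ y → if link k n (suc t , false) y then M *P chains k j n y else []) (partsUpTo j)
    ≡⟨ LP.concatMap-cong (λ y → cong (λ b → if b then M *P chains k j n y else []) (link-plain k n t y))
                         (partsUpTo j) ⟩
  concatMap (λ y → if size y ≡ᵇ suc t then M *P chains k j n y else []) (partsUpTo j)
    ≈⟨ concatMap-parts-size (λ y → M *P chains k j n y) j (s≤s z≤n) t<j ⟩
  (M *P chains k j n (suc t , false)) +P (M *P chains k j n (suc t , true))
    ≈⟨ *P-distribˡ M (chains k j n (suc t , false)) (chains k j n (suc t , true)) ⟨
  M *P chainsOfSize k j n (suc t) ∎
  where
  open ≋-Reasoning
  M = zq 0 (suc t)

chains-overlined-suc : ∀ k j n t → suc t ≤ j →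
  chains k j (suc n) (suc t , true) ≋ (if ⌊ k ∣? suc n ⌋ then zq 1 (suc t) *P chainsOfSize k j n t else [])
chains-overlined-suc k j n t t<j = begin
  chains k j (suc n) (suc t , true)
    ≈⟨ chains-suc k j n (suc t , true) ⟩
  concatMap (λ y → if link k n (suc t , true) y then M *P chains k j n y else []) (partsUpTo j)
    ≡⟨ LP.concatMap-cong (λ y → trans (cong (λ b → if b then M *P chains k j n y else []) (link-overlined k n t y))
                                      (if-∧ ⌊ k ∣? suc n ⌋ (size y ≡ᵇ t) (M *P chains k j n y))) (partsUpTo j) ⟩
  concatMap (λ y → if ⌊ k ∣? suc n ⌋ then G y else []) (partsUpTo j)
    ≡⟨ concatMap-if ⌊ k ∣? suc n ⌋ G (partsUpTo j) ⟩
  (if ⌊ k ∣? suc n ⌋ then concatMap G (partsUpTo j) else [])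
    ≈⟨ guarded ⌊ k ∣? suc n ⌋ ⟩
  (if ⌊ k ∣? suc n ⌋ then M *P chainsOfSize k j n t else []) ∎
  where
  open ≋-Reasoning
  M = zq 1 (suc t)
  G : Part → Poly
  G y = if size y ≡ᵇ t then M *P chains k j n y else []
  sizes : ∀ u → u < j →
    concatMap (λ y → if size y ≡ᵇ u then M *P chains k j n y else []) (partsUpTo j) ≋ M *P chainsOfSize k j n u
  sizes zero    _   = ≋-trans (concatMap-vanishes (All.universal G0-vanishes (partsUpTo j)))
                              (≡⇒≋ (cong (M *P_) (sym (chainsOfSize-zero k j n))))
    where
    G0-vanishes : ∀ y → (if size y ≡ᵇ 0 then M *P chains k j n y else []) ≋ []
    G0-vanishes (zero  , o) = ≡⇒≋ (cong (M *P_) (chains-zero-size k j n o))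
    G0-vanishes (suc _ , o) = ≋-refl
  sizes (suc t) t<j = ≋-trans (concatMap-parts-size (λ y → M *P chains k j n y) j (s≤s z≤n) (ℕP.<⇒≤ t<j))
                              (≋-sym (*P-distribˡ M (chains k j n (suc t , false)) (chains k j n (suc t , true))))
  guarded : ∀ b → (if b then concatMap G (partsUpTo j) else []) ≋ (if b then M *P chainsOfSize k j n t else [])
  guarded false = ≋-refl
  guarded true  = sizes t t<j

chainsOfSize-suc : ∀ k j n t → suc t ≤ j → chainsOfSize k j (suc n) (suc t)
  ≋ (zq 0 (suc t) *P chainsOfSize k j n (suc t)) +P (if ⌊ k ∣? suc n ⌋ then zq 1 (suc t) *P chainsOfSize k j n t else [])
chainsOfSize-suc k j n t t<j = +P-cong (chains-plain-suc k j n t t<j) (chains-overlined-suc k j n t t<j)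

chainsOfSize-shift : ∀ k j a b t → b < k → suc t ≤ j →
  chainsOfSize k j (b + a * k) (suc t) ≋ zq 0 (b * suc t) *P chainsOfSize k j (a * k) (suc t)
chainsOfSize-shift k j a zero    t _   _   = ≡⇒≋ (sym (*P-identityˡ (chainsOfSize k j (a * k) (suc t))))
chainsOfSize-shift k j a (suc b) t b<k t<j = begin
  chainsOfSize k j (suc (b + a * k)) (suc t)
    ≈⟨ chainsOfSize-suc k j (b + a * k) t t<j ⟩
  (zq 0 (suc t) *P chainsOfSize k j (b + a * k) (suc t)) +P (if ⌊ k ∣? suc b + a * k ⌋ then X else [])
    ≡⟨ cong (λ d → (zq 0 (suc t) *P chainsOfSize k j (b + a * k) (suc t)) +P (if d then X else []))
            (∤⇒⌊∣?⌋≡false (suc[b]<k⇒k∤suc[b]+a*k a b b<k)) ⟩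
  (zq 0 (suc t) *P chainsOfSize k j (b + a * k) (suc t)) +P []
    ≡⟨ LP.++-identityʳ _ ⟩
  zq 0 (suc t) *P chainsOfSize k j (b + a * k) (suc t)
    ≈⟨ *P-congˡ (zq 0 (suc t)) (chainsOfSize-shift k j a b t (ℕP.<-trans (ℕP.n<1+n b) b<k) t<j) ⟩
  zq 0 (suc t) *P (zq 0 (b * suc t) *P chainsOfSize k j (a * k) (suc t))
    ≡⟨ *P-assoc (zq 0 (suc t)) (zq 0 (b * suc t)) (chainsOfSize k j (a * k) (suc t)) ⟨
  zq 0 (suc b * suc t) *P chainsOfSize k j (a * k) (suc t) ∎
  where
  open ≋-Reasoning
  X = zq 1 (suc t) *P chainsOfSize k j (b + a * k) t

chainsOfSize-next-multiple : ∀ k′ j a t → suc t ≤ j → chainsOfSize (suc k′) j (suc a * suc k′) (suc t)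
  ≋ (zq 0 (suc t) *P (zq 0 (k′ * suc t) *P chainsOfSize (suc k′) j (a * suc k′) (suc t)))
    +P (zq 1 (suc t) *P chainsOfSize (suc k′) j (k′ + a * suc k′) t)
chainsOfSize-next-multiple k′ j a t t<j = begin
  chainsOfSize k j (suc (k′ + a * k)) (suc t)
    ≈⟨ chainsOfSize-suc k j (k′ + a * k) t t<j ⟩
  (zq 0 (suc t) *P chainsOfSize k j (k′ + a * k) (suc t)) +P (if ⌊ k ∣? suc a * k ⌋ then X else [])
    ≡⟨ cong (λ d → (zq 0 (suc t) *P chainsOfSize k j (k′ + a * k) (suc t)) +P (if d then X else []))
            (∣⇒⌊∣?⌋≡true (n∣m*n (suc a))) ⟩
  (zq 0 (suc t) *P chainsOfSize k j (k′ + a * k) (suc t)) +P X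
    ≈⟨ +P-cong (*P-congˡ (zq 0 (suc t)) (chainsOfSize-shift k j a k′ t (ℕP.n<1+n k′) t<j)) ≋-refl ⟩
  (zq 0 (suc t) *P (zq 0 (k′ * suc t) *P chainsOfSize k j (a * k) (suc t))) +P X ∎
  where
  open ≋-Reasoning
  k = suc k′
  X = zq 1 (suc t) *P chainsOfSize k j (k′ + a * k) t

chainsOfSize-multiple : ∀ k j a t → 1 ≤ k → suc t ≤ j →
  chainsOfSize k j (a * k) (suc t) ≋ (zq t 0 +P zq (suc t) 0) *P (zq 0 (a * k + suc t) *P qBinom k a t)
-- For a = 0 the only candidate is the one-part sequence, whose overlined version needs k ∣ 0.
chainsOfSize-multiple k j zero zero _ _ =
  ≡⇒≋ (cong (λ d → (zq 0 1 ++ []) ++ ((if (d ∧ true) ∧ true then zq 1 1 else []) ++ []))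
            (∣⇒⌊∣?⌋≡true (k ∣0)))
chainsOfSize-multiple k j zero (suc t) _ _ =
  ≡⇒≋ (cong (λ d → (if (d ∧ true) ∧ false then monomial ((suc (suc t) , true) ∷ []) else []) ++ [])
            (∣⇒⌊∣?⌋≡true (k ∣0)))
chainsOfSize-multiple k@(suc k′) j (suc a) zero _ 1≤j = begin
  chainsOfSize k j (suc (k′ + a * k)) 1
    ≈⟨ chainsOfSize-next-multiple k′ j a zero 1≤j ⟩
  (zq 0 1 *P (zq 0 (k′ * 1) *P chainsOfSize k j (a * k) 1)) +P (zq 1 1 *P chainsOfSize k j (k′ + a * k) 0)
    ≡⟨ cong (λ X → (zq 0 1 *P (zq 0 (k′ * 1) *P chainsOfSize k j (a * k) 1)) +P (zq 1 1 *P X))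
            (chainsOfSize-zero k j (k′ + a * k)) ⟩
  (zq 0 1 *P (zq 0 (k′ * 1) *P chainsOfSize k j (a * k) 1)) +P []
    ≈⟨ +P-cong (*P-congˡ (zq 0 1) (*P-congˡ (zq 0 (k′ * 1)) (chainsOfSize-multiple k j a zero (s≤s z≤n) 1≤j)))
               ≋-refl ⟩
  (zq 0 1 *P (zq 0 (k′ * 1) *P (Z *P (zq 0 (a * k + 1) *P oneP)))) +P []
    ≈⟨ solve 4 (λ A B Z C → A :* (B :* (Z :* (C :* con 1))) :+ con 0 := Z :* (((A :* B) :* C) :* con 1)) ≋-refl
             (zq 0 1) (zq 0 (k′ * 1)) Z (zq 0 (a * k + 1)) ⟩
  Z *P (((zq 0 1 *P zq 0 (k′ * 1)) *P zq 0 (a * k + 1)) *P oneP)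
    ≡⟨ cong (λ e → Z *P (zq 0 e *P oneP)) (exponent k′ a) ⟩
  Z *P (zq 0 (suc a * k + 1) *P oneP) ∎
  where
  open ≋-Reasoning
  Z = zq 0 0 +P zq 1 0
  exponent : ∀ k′ a → 1 + k′ * 1 + (a * suc k′ + 1) ≡ suc a * suc k′ + 1
  exponent = solve-∀
chainsOfSize-multiple k@(suc k′) j (suc a) (suc t) _ t<j = begin
  chainsOfSize k j (suc a * k) (suc (suc t))
    ≈⟨ chainsOfSize-next-multiple k′ j a (suc t) t<j ⟩
  (Y *P (K₁ *P chainsOfSize k j (a * k) (suc (suc t)))) +P ((z *P Y) *P chainsOfSize k j (k′ + a * k) (suc t))
    ≈⟨ +P-cong (*P-congˡ Y (*P-congˡ K₁ (chainsOfSize-multiple k j a (suc t) (s≤s z≤n) t<j)))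
               (*P-congˡ (z *P Y) (≋-trans (chainsOfSize-shift k j a k′ t (ℕP.n<1+n k′) (ℕP.<⇒≤ t<j))
                                           (*P-congˡ K₀ (chainsOfSize-multiple k j a t (s≤s z≤n) (ℕP.<⇒≤ t<j))))) ⟩
  (Y *P (K₁ *P (Z₁ *P (Q₁ *P B₁)))) +P ((z *P Y) *P (K₀ *P (Z₀ *P (Q₀ *P B₀))))
    ≈⟨ solve 10 (λ Y K₁ K₀ z Z₁ Z₀ Q₁ Q₀ B₁ B₀ →
         Y :* (K₁ :* (Z₁ :* (Q₁ :* B₁))) :+ (z :* Y) :* (K₀ :* (Z₀ :* (Q₀ :* B₀)))
         := Z₁ :* (((Y :* K₁) :* Q₁) :* B₁) :+ (z :* Z₀) :* (((Y :* K₀) :* Q₀) :* B₀))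
         ≋-refl Y K₁ K₀ z Z₁ Z₀ Q₁ Q₀ B₁ B₀ ⟩
  (Z₁ *P (((Y *P K₁) *P Q₁) *P B₁)) +P ((z *P Z₀) *P (((Y *P K₀) *P Q₀) *P B₀))
    ≡⟨ cong₂ (λ e e′ → (Z₁ *P (zq 0 e *P B₁)) +P (Z₁ *P (zq 0 e′ *P B₀)))
             (exponent₁ k′ a t) (exponent₀ k′ a t) ⟩
  (Z₁ *P ((Q *P zq 0 (k * suc t)) *P B₁)) +P (Z₁ *P ((Q *P zq 0 (k * t)) *P B₀))
    ≈⟨ solve 6 (λ Z₁ Q D₁ D₀ B₁ B₀ → Z₁ :* ((Q :* D₁) :* B₁) :+ Z₁ :* ((Q :* D₀) :* B₀)
                := Z₁ :* (Q :* (D₁ :* B₁ :+ D₀ :* B₀)))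
         ≋-refl Z₁ Q (zq 0 (k * suc t)) (zq 0 (k * t)) B₁ B₀ ⟩
  Z₁ *P (Q *P qBinom k (suc a) (suc t)) ∎
  where
  open ≋-Reasoning
  z = zq 1 0
  Y = zq 0 (suc (suc t))
  K₁ = zq 0 (k′ * suc (suc t))
  K₀ = zq 0 (k′ * suc t)
  Z₁ = zq (suc t) 0 +P zq (suc (suc t)) 0
  Z₀ = zq t 0 +P zq (suc t) 0
  Q₁ = zq 0 (a * k + suc (suc t))
  Q₀ = zq 0 (a * k + suc t)
  Q = zq 0 (suc a * k + suc (suc t))
  B₁ = qBinom k a (suc t)
  B₀ = qBinom k a t
  exponent₁ : ∀ k′ a t → suc (suc t) + k′ * suc (suc t) + (a * suc k′ + suc (suc t))
                       ≡ suc a * suc k′ + suc (suc t) + suc k′ * suc t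
  exponent₁ = solve-∀
  exponent₀ : ∀ k′ a t → suc (suc t) + k′ * suc t + (a * suc k′ + suc t)
                       ≡ suc a * suc k′ + suc (suc t) + suc k′ * t
  exponent₀ = solve-∀

GL-closedForm : ∀ k s m j → 2 ≤ s → s ≤ k →
  GL k (k * m + s) (suc j) ≋ (zq j 0 +P zq (suc j) 0) *P (zq 0 (s * suc j + m * k) *P qBinom k m j)
GL-closedForm k@(suc k′) s@(suc (suc s′)) m j (s≤s (s≤s z≤n)) s≤k = begin
  GL k (k * m + s) (suc j)
    ≡⟨ cong (λ n → GL k n (suc j)) (size-eq k′ s′ m) ⟩
  GL k (suc (suc n)) (suc j)
    ≈⟨ GL-chains k (suc j) (suc n) (s≤s z≤n) ⟩
  chains k (suc j) (suc n) (suc j , false)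
    ≈⟨ chains-plain-suc k (suc j) n j ℕP.≤-refl ⟩
  Y *P chainsOfSize k (suc j) (s′ + m * k) (suc j)
    ≈⟨ *P-congˡ Y (chainsOfSize-shift k (suc j) m s′ j (ℕP.≤-trans (ℕP.n≤1+n (suc s′)) s≤k) ℕP.≤-refl) ⟩
  Y *P (S *P chainsOfSize k (suc j) (m * k) (suc j))
    ≈⟨ *P-congˡ Y (*P-congˡ S (chainsOfSize-multiple k (suc j) m j (s≤s z≤n) ℕP.≤-refl)) ⟩
  Y *P (S *P (Z *P (Q *P B)))
    ≈⟨ solve 5 (λ Y S Z Q B → Y :* (S :* (Z :* (Q :* B))) := Z :* (((Y :* S) :* Q) :* B)) ≋-refl Y S Z Q B ⟩
  Z *P (((Y *P S) *P Q) *P B)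
    ≡⟨ cong (λ e → Z *P (zq 0 e *P B)) (exponent s′ j (m * k)) ⟩
  Z *P (zq 0 (s * suc j + m * k) *P B) ∎
  where
  open ≋-Reasoning
  n = s′ + m * k
  Y = zq 0 (suc j)
  S = zq 0 (s′ * suc j)
  Z = zq j 0 +P zq (suc j) 0
  Q = zq 0 (m * k + suc j)
  B = qBinom k m j
  size-eq : ∀ k′ s′ m → suc k′ * m + suc (suc s′) ≡ suc (suc (s′ + m * suc k′))
  size-eq = solve-∀
  exponent : ∀ s′ j x → suc j + s′ * suc j + (x + suc j) ≡ suc (suc s′) * suc j + x
  exponent = solve-∀

lemma3p5 : (k : ℕ) → 2 ≤ k → (s : ℕ) → 2 ≤ s → s ≤ k → (m j : ℕ) → 2 ≤ j → j ≤ m →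
    ((GL k (k * (m ∸ 1) + s) j *P qPoch k (j ∸ 1)) *P qPoch k (m ∸ j))
    ≈P (((zq (j ∸ 1) 0 +P zq j 0) *P zq 0 (k * (j C 2) + s * j + k * (m ∸ j))) *P qPoch k (m ∸ 1))
lemma3p5 k _ s 2≤s s≤k (suc m) (suc j) _ (s≤s j≤m) = coeff-≡ (begin
  (GL k (k * m + s) (suc j) *P qPoch k j) *P qPoch k (m ∸ j)
    ≈⟨ *P-cong (*P-cong (GL-closedForm k s m j 2≤s s≤k) ≋-refl) ≋-refl ⟩
  ((Z *P (Q *P B)) *P qPoch k j) *P qPoch k (m ∸ j)
    ≈⟨ solve 5 (λ Z Q B Pj Pmj → ((Z :* (Q :* B)) :* Pj) :* Pmj := (Z :* Q) :* ((B :* Pj) :* Pmj))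
             ≋-refl Z Q B (qPoch k j) (qPoch k (m ∸ j)) ⟩
  (Z *P Q) *P ((B *P qPoch k j) *P qPoch k (m ∸ j))
    ≈⟨ *P-congˡ (Z *P Q) (qBinom-qPoch k j≤m) ⟩
  (Z *P Q) *P (zq 0 (k * (j C 2)) *P qPoch k m)
    ≈⟨ solve 4 (λ Z Q X Pm → (Z :* Q) :* (X :* Pm) := (Z :* (Q :* X)) :* Pm)
               ≋-refl Z Q (zq 0 (k * (j C 2))) (qPoch k m) ⟩
  (Z *P (Q *P zq 0 (k * (j C 2)))) *P qPoch k m
    ≡⟨ cong (λ e → (Z *P zq 0 e) *P qPoch k m) exponent ⟩
  (Z *P zq 0 (k * (suc j C 2) + s * suc j + k * (m ∸ j))) *P qPoch k m ∎)
  where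
  open ≋-Reasoning
  Z = zq j 0 +P zq (suc j) 0
  Q = zq 0 (s * suc j + m * k)
  B = qBinom k m j
  exponent : s * suc j + m * k + k * (j C 2) ≡ k * (suc j C 2) + s * suc j + k * (m ∸ j)
  exponent = trans (cong (λ x → s * suc j + x * k + k * (j C 2)) (sym (ℕP.m+[n∸m]≡n j≤m)))
             (trans (rearrange s j (m ∸ j) k (j C 2))
                    (cong (λ x → x + s * suc j + k * (m ∸ j)) (kC2-suc k j)))
    where
    rearrange : ∀ s j d k c → s * suc j + (j + d) * k + k * c ≡ k * j + k * c + s * suc j + k * d
    rearrange = solve-∀
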